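{- Let $n=m^2$ for a positive integer $m$. Every nondeterministic OBDD (NOBDD) computing $\mathtt{notPERM}_n$ has width at least $\sqrt{n}-\frac{5}{4}\log_2 n-1$.
   Context: For $n=m^2$, inputs $\sigma\in\{0,1\}^n$ have bits indexed $x_{1,1},\dots,x_{1,m},\dots,x_{m,1},\dots,x_{m,m}$ and define the $m\times m$ 0-1 matrix $A(\sigma)$ with $(i,j)$ entry $x_{i,j}$. $\mathtt{notPERM}_n(\sigma)=0$ if $A(\sigma)$ is a permutation matrix, and $1$ otherwise. An OBDD on variables $x_1,\dots,x_n$ is a directed acyclic graph with one source whose nodes are partitioned into levels $V_0,\dots,V_\ell$; the nodes of $V_\ell$ are sinks, each accepting or rejecting; all nodes of a level $V_j$ ($j<\ell$) query the same variable and have outgoing edges labelled 0 and 1 only to nodes of $V_{j+1}$; each variable is queried at most once on every source-to-sink path. In a nondeterministic OBDD (NOBDD) a node may have several outgoing edges with the same label, and an input is accepted iff at least one computation path consistent with it reaches an accepting sink. It computes $f$ if it accepts exactly the inputs in $f^{ -1}(1)$. The width is $\max_j|V_j|$. -}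

module Defs where

open import Data.Nat using (ℕ; suc; _⊔_)
open import Data.Fin using (Fin; zero; suc; inject₁; fromℕ; combine)
open import Data.Bool using (Bool; true)
open import Data.Product using (Σ; ∃; _×_)
open import Data.Vec.Functional using (foldr)
open import Relation.Binary.PropositionalEquality using (_≡_)
open import Relation.Nullary using (¬_)
open import Function.Bundles using (_⇔_)

-- Inputs on n variables: σ : Fin n → Bool (σ i is the value of x_{i+1}).

-- Levels V_0 … V_ℓ; level j has `size j` nodes (Fin (size j)).
-- Level j < ℓ queries variable `var j`.
-- `edge j u b v ≡ true` : there is an edge labelled b from node u of V_j
-- to node v of V_{j+1}.  Nodes of V_ℓ are sinks, accepting or rejecting.
record NOBDD (n : ℕ) : Set where
  field
    ℓ         : ℕ
    size      : Fin (suc ℓ) → ℕ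
    var       : Fin ℓ → Fin n
    edge      : (j : Fin ℓ) → Fin (size (inject₁ j)) → Bool → Fin (size (suc j)) → Bool
    accepting : Fin (size (fromℕ ℓ)) → Bool
    -- one source: V_0 consists of the source only, and every other node
    -- has an incoming edge (so it is not a source)
    single-source : size zero ≡ 1
    has-pred  : (j : Fin ℓ) (v : Fin (size (suc j))) →
                Σ (Fin (size (inject₁ j))) λ u → Σ Bool λ b → edge j u b v ≡ true

  GraphPath : Set
  GraphPath = Σ ((j : Fin (suc ℓ)) → Fin (size j)) λ p →
                (j : Fin ℓ) → Σ Bool λ b → edge j (p (inject₁ j)) b (p (suc j)) ≡ true

  CompPath : (Fin n → Bool) → Set
  CompPath σ = Σ ((j : Fin (suc ℓ)) → Fin (size j)) λ p →
                 ((j : Fin ℓ) → edge j (p (inject₁ j)) (σ (var j)) (p (suc j)) ≡ true)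
                 × accepting (p (fromℕ ℓ)) ≡ true

  Accepts : (Fin n → Bool) → Set
  Accepts σ = CompPath σ

  width : ℕ
  width = foldr _⊔_ 0 size

-- An NOBDD: a leveled OBDD in which every variable is queried at most once
-- on every source-to-sink path.  Every such path visits each level once, in
-- order, so this says: the levels on such a path query distinct variables.
ReadOnce : ∀ {n} → NOBDD n → Set
ReadOnce B = GraphPath → (i j : Fin ℓ) → var i ≡ var j → i ≡ j
  where open NOBDD B

-- B computes f (given as the predicate "f σ = 1")
Computes : ∀ {n} → NOBDD n → ((Fin n → Bool) → Set) → Set
Computes B F = ∀ σ → NOBDD.Accepts B σ ⇔ F σ

-- The m×m matrix A(σ): entry (i,j) is x_{i,j} = bit number i·m + j (0-based)
Matrix : (m : ℕ) → (Fin (m Data.Nat.* m) → Bool) → Fin m → Fin m → Bool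
Matrix m σ i j = σ (combine i j)

IsPermutationMatrix : (m : ℕ) → (Fin m → Fin m → Bool) → Set
IsPermutationMatrix m A =
  ((i : Fin m) → Σ (Fin m) λ j → A i j ≡ true × ((j' : Fin m) → A i j' ≡ true → j' ≡ j))
  × ((j : Fin m) → Σ (Fin m) λ i → A i j ≡ true × ((i' : Fin m) → A i' j ≡ true → i' ≡ i))

NotPERM : (m : ℕ) → (Fin (m Data.Nat.* m) → Bool) → Set
NotPERM m σ = ¬ IsPermutationMatrix m (Matrix m σ)

module Submission where

-- Width lower bound for read-once NOBDDs computing notPERM on m × m
-- matrices: 4^(m−(w+1)) ≤ m⁵, i.e. w ≥ √n − (5/4)·log₂ n − 1 for n = m².
--
-- Each variable is read on exactly one level.  Cut the
-- levels of B where exactly k = ⌊m/2⌋ rows of a permutation π have their one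
-- read ("early" rows; a discrete intermediate value argument).  If π and ρ
-- reach the same nodes at the cut, reading π before it and ρ after it must
-- give a permutation matrix (else cut and paste makes ρ accepted), so π and
-- ρ have the same early rows and columns.  Thus π is determined by the cut
-- level (< m²), the reached set (< 2^w) and the bijections between early
-- rows and columns (< k!) and between late ones (< (m−k)!); encoding this as
-- a number yields m! ≤ m²·2^w·k!·(m−k)!, which with C(m,k)² ≥ 4^(m−1)/m is
-- the bound.

open import Defs
open import Data.Nat using (ℕ; _*_; _+_; _∸_; _^_; _≤_)
open import Data.Nat
open import Data.Nat.Properties
open import Data.Nat.DivMod using (_%_; [m+kn]%n≡m%n; m<n⇒m%n≡m)
open import Data.Nat.Tactic.RingSolver using (solve-∀)
open import Data.Fin using (Fin; zero; suc; toℕ; fromℕ; fromℕ<; inject₁; punchIn; remQuot; combine)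
import Data.Fin as F
open import Data.Fin.Properties
  using (toℕ-fromℕ<; toℕ-injective; toℕ-inject₁; toℕ<n; toℕ-fromℕ; injective⇒≤; punchIn-injective;
         remQuot-combine; combine-remQuot; combine-injectiveˡ; any?)
  renaming (suc-injective to Fin-suc-injective)
open import Data.Fin.Permutation
  using (Permutation′; _⟨$⟩ʳ_; _⟨$⟩ˡ_; inverseˡ; inverseʳ; insert; insert-punchIn)
import Data.Fin.Permutation as Perm
open import Data.Bool using (Bool; true; false; not; _∧_; _∨_; if_then_else_)
import Data.Bool.Properties as Bool
open import Data.Product using (Σ; _×_; _,_; proj₁; proj₂)
open import Data.Sum using (_⊎_; inj₁; inj₂)
open import Data.Empty using (⊥-elim)
open import Relation.Nullary using (Dec; yes; no; does; ¬_; contradiction)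
open import Relation.Nullary.Decidable using (dec-true; dec-false; decidable-stable)
open import Relation.Binary.PropositionalEquality
open import Relation.Binary.Definitions using (tri<; tri≈; tri>)
open import Function using (_∘_)
open import Function.Bundles using (Equivalence)
import Data.Vec.Functional as Vector

does-true : ∀ {P : Set} (P? : Dec P) → does P? ≡ true → P
does-true (yes p) _ = p

∧-intro : ∀ {a b} → a ≡ true → b ≡ true → a ∧ b ≡ true
∧-intro refl refl = refl

∧-elimˡ : ∀ a {b} → a ∧ b ≡ true → a ≡ true
∧-elimˡ true _ = refl

∧-elimʳ : ∀ a {b} → a ∧ b ≡ true → b ≡ true
∧-elimʳ true h = h

_⊆_ : ∀ {n} → (Fin n → Bool) → (Fin n → Bool) → Set
P ⊆ Q = ∀ x → P x ≡ true → Q x ≡ true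

ind : Bool → ℕ
ind true = 1
ind false = 0

ind-mono : ∀ a b → (a ≡ true → b ≡ true) → ind a ≤ ind b
ind-mono true b h rewrite h refl = ≤-refl
ind-mono false b h = z≤n

count : ∀ {n} → (Fin n → Bool) → ℕ
count {zero} P = 0
count {suc n} P = ind (P zero) + count (P ∘ suc)

count-cong : ∀ {n} {P Q : Fin n → Bool} → (∀ x → P x ≡ Q x) → count P ≡ count Q
count-cong {zero} e = refl
count-cong {suc n} e = cong₂ _+_ (cong ind (e zero)) (count-cong (e ∘ suc))

count-empty : ∀ {n} (P : Fin n → Bool) → (∀ x → P x ≡ false) → count P ≡ 0
count-empty {zero} P e = refl
count-empty {suc n} P e rewrite e zero = count-empty (P ∘ suc) (e ∘ suc)

count-full : ∀ {n} (P : Fin n → Bool) → (∀ x → P x ≡ true) → count P ≡ n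
count-full {zero} P e = refl
count-full {suc n} P e rewrite e zero = cong suc (count-full (P ∘ suc) (e ∘ suc))

count-complement : ∀ {n} (P : Fin n → Bool) → count (not ∘ P) ≡ n ∸ count P
count-complement {n} P = sym (trans (cong (_∸ count P) (sym (partition P))) (m+n∸m≡n (count P) _))
  where
  partition : ∀ {n} (P : Fin n → Bool) → count P + count (not ∘ P) ≡ n
  partition {zero} P = refl
  partition {suc n} P with P zero
  ... | true = cong suc (partition (P ∘ suc))
  ... | false = trans (+-suc (count (P ∘ suc)) _) (cong suc (partition (P ∘ suc)))

count-mono : ∀ {n} {P Q : Fin n → Bool} → P ⊆ Q → count P ≤ count Q
count-mono {zero} h = z≤n
count-mono {suc n} {P} {Q} h = +-mono-≤ (ind-mono (P zero) (Q zero) (h zero)) (count-mono (h ∘ suc))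

count-strict : ∀ {n} {P Q : Fin n → Bool} → P ⊆ Q → (y : Fin n) → P y ≡ false → Q y ≡ true →
               count P < count Q
count-strict {suc n} h zero py qy rewrite py | qy = s≤s (count-mono (h ∘ suc))
count-strict {suc n} {P} {Q} h (suc y) py qy =
  +-mono-≤-< (ind-mono (P zero) (Q zero) (h zero)) (count-strict (h ∘ suc) y py qy)

count-∨ : ∀ {n} (P Q : Fin n → Bool) → count (λ x → P x ∨ Q x) ≤ count P + count Q
count-∨ {zero} P Q = z≤n
count-∨ {suc n} P Q with P zero | Q zero | count-∨ (P ∘ suc) (Q ∘ suc)
... | true  | true  | ih = s≤s (≤-trans ih (≤-trans (n≤1+n _) (≤-reflexive (sym (+-suc _ _)))))
... | true  | false | ih = s≤s ih
... | false | true  | ih = ≤-trans (s≤s ih) (≤-reflexive (sym (+-suc _ _)))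
... | false | false | ih = ih

count-atMostOne : ∀ {n} (P : Fin n → Bool) → (∀ x y → P x ≡ true → P y ≡ true → x ≡ y) →
                  count P ≤ 1
count-atMostOne {zero} P h = z≤n
count-atMostOne {suc n} P h with P zero in p0
... | true = ≤-reflexive (cong suc (count-empty (P ∘ suc) rest-empty))
  where
  rest-empty : ∀ x → P (suc x) ≡ false
  rest-empty x with P (suc x) in px
  ... | false = refl
  ... | true with () ← h zero (suc x) p0 px
... | false = count-atMostOne (P ∘ suc) λ x y px py → Fin-suc-injective (h (suc x) (suc y) px py)

numeral-< : ∀ {r q t T} → r < q → t < T → r + q * t < q * T
numeral-< {r} {q} {t} {T} r<q t<T = begin-strict
  r + q * t     <⟨ +-monoˡ-< (q * t) r<q ⟩
  q + q * t     ≡⟨ *-suc q t ⟨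
  q * suc t     ≤⟨ *-monoʳ-≤ q t<T ⟩
  q * T         ∎
  where open ≤-Reasoning

numeral-injective : ∀ {q} r r' t t' → r < q → r' < q → r + q * t ≡ r' + q * t' → r ≡ r' × t ≡ t'
numeral-injective {q} r r' t t' r<q r'<q e = r≡r' , *-cancelˡ-≡ t t' q q*t≡q*t'
  where
  instance
    q≢0 : NonZero q
    q≢0 = >-nonZero (m<n⇒0<n r<q)
  digit : ∀ r t → r < q → (r + q * t) % q ≡ r
  digit r t r<q = trans (cong (λ x → (r + x) % q) (*-comm q t)) (trans ([m+kn]%n≡m%n r t q) (m<n⇒m%n≡m r<q))
  r≡r' : r ≡ r'
  r≡r' = trans (sym (digit r t r<q)) (trans (cong (_% q) e) (digit r' t' r'<q))
  q*t≡q*t' : q * t ≡ q * t'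
  q*t≡q*t' = +-cancelˡ-≡ r _ _ (trans e (cong (_+ q * t') (sym r≡r')))

bitsCode : ∀ {n} → (Fin n → Bool) → ℕ
bitsCode {zero} b = 0
bitsCode {suc n} b = ind (b zero) + 2 * bitsCode (b ∘ suc)

ind<2 : ∀ b → ind b < 2
ind<2 true = s≤s (s≤s z≤n)
ind<2 false = s≤s z≤n

bitsCode-< : ∀ {n} (b : Fin n → Bool) → bitsCode b < 2 ^ n
bitsCode-< {zero} b = s≤s z≤n
bitsCode-< {suc n} b = numeral-< (ind<2 (b zero)) (bitsCode-< (b ∘ suc))

bitsCode-injective : ∀ {n} (b c : Fin n → Bool) → bitsCode b ≡ bitsCode c → ∀ x → b x ≡ c x
bitsCode-injective {suc n} b c e x
  with e₀ , e₊ ← numeral-injective (ind (b zero)) (ind (c zero)) (bitsCode (b ∘ suc)) (bitsCode (c ∘ suc))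
                       (ind<2 _) (ind<2 _) e
  with x
... | zero = ind-injective (b zero) (c zero) e₀
  where
  ind-injective : ∀ a b → ind a ≡ ind b → a ≡ b
  ind-injective true true _ = refl
  ind-injective false false _ = refl
... | suc x = bitsCode-injective (b ∘ suc) (c ∘ suc) e₊ x

-- The falling factorial b·(b−1)⋯(b−a+1), the number of injections of an
-- a-set into a b-set.
falling : ℕ → ℕ → ℕ
falling b zero = 1
falling b (suc a) = b * falling (pred b) a

falling-diagonal : ∀ k → falling k k ≡ k !
falling-diagonal zero = refl
falling-diagonal (suc k) = cong (suc k *_) (falling-diagonal k)

falling-positive : ∀ b a → 0 < falling b a → a ≤ b
falling-positive b zero _ = z≤n
falling-positive zero (suc a) ()
falling-positive (suc b) (suc a) pos = s≤s (falling-positive b a (n≢0⇒n>0 λ z →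
  <⇒≢ pos (sym (trans (cong (suc b *_) z) (*-zeroʳ (suc b))))))

<ᵇ-complete : ∀ {m n} → m < n → (m <ᵇ n) ≡ true
<ᵇ-complete {m} {n} = dec-true (m <? n)

<ᵇ-sound : ∀ {m n} → (m <ᵇ n) ≡ true → m < n
<ᵇ-sound {m} {n} = does-true (m <? n)

<ᵇ-false : ∀ {m n} → n ≤ m → (m <ᵇ n) ≡ false
<ᵇ-false {m} {n} n≤m = dec-false (m <? n) (≤⇒≯ n≤m)

rank : ∀ {n} → (Fin n → Bool) → Fin n → ℕ
rank B y = count (λ z → B z ∧ (toℕ z <ᵇ toℕ y))

below-self : ∀ {n} (B : Fin n → Bool) (y : Fin n) → B y ∧ (toℕ y <ᵇ toℕ y) ≡ false
below-self B y rewrite <ᵇ-false {toℕ y} ≤-refl = Bool.∧-zeroʳ (B y)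

rank-< : ∀ {n} (B : Fin n → Bool) y → B y ≡ true → rank B y < count B
rank-< B y By = count-strict (λ x h → ∧-elimˡ (B x) h) y (below-self B y) By

rank-strictMono : ∀ {n} (B : Fin n → Bool) {y y'} → B y ≡ true → toℕ y < toℕ y' →
                  rank B y < rank B y'
rank-strictMono B {y} {y'} By y<y' =
  count-strict below-y⊆below-y' y (below-self B y) (∧-intro By (<ᵇ-complete y<y'))
  where
  below-y⊆below-y' : (λ z → B z ∧ (toℕ z <ᵇ toℕ y)) ⊆ (λ z → B z ∧ (toℕ z <ᵇ toℕ y'))
  below-y⊆below-y' z h =
    ∧-intro (∧-elimˡ (B z) h) (<ᵇ-complete (<-trans (<ᵇ-sound (∧-elimʳ (B z) h)) y<y'))

rank-injective : ∀ {n} (B : Fin n → Bool) {y y'} → B y ≡ true → B y' ≡ true →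
                 rank B y ≡ rank B y' → y ≡ y'
rank-injective B {y} {y'} By By' e with <-cmp (toℕ y) (toℕ y')
... | tri< y<y' _ _ = contradiction e (<⇒≢ (rank-strictMono B By y<y'))
... | tri≈ _ y≡y' _ = toℕ-injective y≡y'
... | tri> _ _ y>y' = contradiction (sym e) (<⇒≢ (rank-strictMono B By' y>y'))

remove : ∀ {n} → (Fin n → Bool) → Fin n → Fin n → Bool
remove B y z = B z ∧ not (does (z F.≟ y))

count-remove : ∀ {n} (B : Fin n → Bool) y → B y ≡ true → suc (count (remove B y)) ≡ count B
count-remove {suc n} B zero By rewrite By = cong suc (count-cong (λ x → Bool.∧-identityʳ (B (suc x))))
count-remove {suc n} B (suc y) By =
  trans (sym (+-suc _ _)) (cong₂ _+_ (cong ind (Bool.∧-identityʳ (B zero))) (count-remove (B ∘ suc) y By))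

record InjectsInto {a b} (A : Fin a → Bool) (B : Fin b → Bool) (f : Fin a → Fin b) : Set where
  field
    maps-into : ∀ x → A x ≡ true → B (f x) ≡ true
    injective : ∀ x y → A x ≡ true → A y ≡ true → f x ≡ f y → x ≡ y
open InjectsInto

restrict : ∀ {a b} {A : Fin (suc a) → Bool} {B : Fin b → Bool} {f} →
           InjectsInto A B f → InjectsInto (A ∘ suc) B (f ∘ suc)
restrict ι = record
  { maps-into = λ x → maps-into ι (suc x)
  ; injective = λ x y Ax Ay e → Fin-suc-injective (injective ι _ _ Ax Ay e) }

restrict-used : ∀ {a b} {A : Fin (suc a) → Bool} {B : Fin b → Bool} {f} → A zero ≡ true →
                InjectsInto A B f → InjectsInto (A ∘ suc) (remove B (f zero)) (f ∘ suc)
restrict-used {A = A} {B} {f} A0 ι = record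
  { maps-into = λ x Ax → ∧-intro (maps-into ι (suc x) Ax)
                  (cong not (dec-false (f (suc x) F.≟ f zero) λ e → 0≢suc (injective ι _ _ A0 Ax (sym e))))
  ; injective = injective (restrict ι) }
  where
  0≢suc : ∀ {n} {x : Fin n} → zero ≢ suc x
  0≢suc ()

-- injCode A B f encodes the restriction of f to A as a number: the images of
-- the elements of A are listed in order, each by its rank among the elements
-- of B not used so far.
injCode : ∀ {a b} → (Fin a → Bool) → (Fin b → Bool) → (Fin a → Fin b) → ℕ
injCode {zero} A B f = 0
injCode {suc a} A B f =
  if A zero then rank B (f zero) + count B * injCode (A ∘ suc) (remove B (f zero)) (f ∘ suc)
  else injCode (A ∘ suc) B (f ∘ suc)

injCode-< : ∀ {a b} {A : Fin a → Bool} {B : Fin b → Bool} {f} →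
            InjectsInto A B f → injCode A B f < falling (count B) (count A)
injCode-< {zero} ι = s≤s z≤n
injCode-< {suc a} {A = A} {B} {f} ι with A zero in A0
... | true = numeral-< (rank-< B (f zero) B-f0) tail-bound
  where
  B-f0 = maps-into ι zero A0
  tail-code = injCode (A ∘ suc) (remove B (f zero)) (f ∘ suc)
  tail-bound : tail-code < falling (pred (count B)) (count (A ∘ suc))
  tail-bound = subst (λ c → tail-code < falling c (count (A ∘ suc)))
                     (cong pred (count-remove B (f zero) B-f0)) (injCode-< (restrict-used A0 ι))
... | false = injCode-< (restrict ι)

injection-count-≤ : ∀ {a b} {A : Fin a → Bool} {B : Fin b → Bool} {f} →
                    InjectsInto A B f → count A ≤ count B
injection-count-≤ ι = falling-positive _ _ (≤-trans (s≤s z≤n) (injCode-< ι))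

injCode-cong : ∀ {a b} {A A' : Fin a → Bool} {B B' : Fin b → Bool} →
               (∀ x → A x ≡ A' x) → (∀ y → B y ≡ B' y) → ∀ f → injCode A B f ≡ injCode A' B' f
injCode-cong {zero} eA eB f = refl
injCode-cong {suc a} {A = A} {A'} {B} {B'} eA eB f rewrite sym (eA zero) with A zero
... | true = cong₂ _+_ (count-cong (λ z → cong (_∧ (toℕ z <ᵇ toℕ (f zero))) (eB z)))
               (cong₂ _*_ (count-cong eB)
                 (injCode-cong (eA ∘ suc) (λ y → cong (_∧ not (does (y F.≟ f zero))) (eB y)) (f ∘ suc)))
... | false = injCode-cong (eA ∘ suc) eB (f ∘ suc)

injCode-injective : ∀ {a b} {A : Fin a → Bool} {B : Fin b → Bool} {f g} →
                    InjectsInto A B f → InjectsInto A B g → injCode A B f ≡ injCode A B g →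
                    ∀ x → A x ≡ true → f x ≡ g x
injCode-injective {suc a} {A = A} {B} {f} {g} ιf ιg e x Ax with A zero in A0
injCode-injective {suc a} {A = A} {B} {f} {g} ιf ιg e zero Ax | false with () ← trans (sym Ax) A0
injCode-injective {suc a} {A = A} {B} {f} {g} ιf ιg e (suc x) Ax | false =
  injCode-injective (restrict ιf) (restrict ιg) e x Ax
injCode-injective {suc a} {A = A} {B} {f} {g} ιf ιg e x Ax | true = agree x Ax
  where
  Bf0 = maps-into ιf zero A0
  Bg0 = maps-into ιg zero A0
  digits = numeral-injective _ _ _ _ (rank-< B (f zero) Bf0) (rank-< B (g zero) Bg0) e
  f0≡g0 : f zero ≡ g zero
  f0≡g0 = rank-injective B Bf0 Bg0 (proj₁ digits)
  ιf' : InjectsInto (A ∘ suc) (remove B (g zero)) (f ∘ suc)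
  ιf' = subst (λ y → InjectsInto (A ∘ suc) (remove B y) (f ∘ suc)) f0≡g0 (restrict-used A0 ιf)
  tail≡ : injCode (A ∘ suc) (remove B (g zero)) (f ∘ suc) ≡ injCode (A ∘ suc) (remove B (g zero)) (g ∘ suc)
  tail≡ = trans (cong (λ y → injCode (A ∘ suc) (remove B y) (f ∘ suc)) (sym f0≡g0)) (proj₂ digits)
  agree : ∀ x → A x ≡ true → f x ≡ g x
  agree zero _ = f0≡g0
  agree (suc x) Ax = injCode-injective ιf' (restrict-used A0 ιg) tail≡ x Ax

InjectsInto-cong : ∀ {a b} {A A' : Fin a → Bool} {B B' : Fin b → Bool} {f} →
                   (∀ x → A x ≡ A' x) → (∀ y → B y ≡ B' y) → InjectsInto A B f → InjectsInto A' B' f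
InjectsInto-cong eA eB ι = record
  { maps-into = λ x A'x → trans (sym (eB _)) (maps-into ι x (trans (eA x) A'x))
  ; injective = λ x y A'x A'y → injective ι x y (trans (eA x) A'x) (trans (eA y) A'y) }

injCode-injective′ : ∀ {a b} {A A' : Fin a → Bool} {B B' : Fin b → Bool} {f g} →
                     (∀ x → A x ≡ A' x) → (∀ y → B y ≡ B' y) →
                     InjectsInto A B f → InjectsInto A' B' g → injCode A B f ≡ injCode A' B' g →
                     ∀ x → A x ≡ true → f x ≡ g x
injCode-injective′ {g = g} eA eB ιf ιg e =
  injCode-injective ιf (InjectsInto-cong (sym ∘ eA) (sym ∘ eB) ιg)
                    (trans e (injCode-cong (sym ∘ eA) (sym ∘ eB) g))

-- Lehmer decoding: every number below n! names a permutation of Fin n (the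
-- image of 0, followed recursively by the permutation induced on the rest),
-- and distinct numbers name distinct permutations.
lehmer : ∀ n → Fin (n !) → Permutation′ n
lehmer zero _ = Perm.id
lehmer (suc n) x =
  insert zero (proj₁ (remQuot {suc n} (n !) x)) (lehmer n (proj₂ (remQuot {suc n} (n !) x)))

lehmer-injective : ∀ n (x y : Fin (n !)) → (∀ i → lehmer n x ⟨$⟩ʳ i ≡ lehmer n y ⟨$⟩ʳ i) → x ≡ y
lehmer-injective zero zero zero _ = refl
lehmer-injective (suc n) x y e = begin
  x                     ≡⟨ combine-remQuot {suc n} (n !) x ⟨
  combine a₁ r₁         ≡⟨ cong₂ combine a₁≡a₂ r₁≡r₂ ⟩
  combine a₂ r₂         ≡⟨ combine-remQuot {suc n} (n !) y ⟩
  y                     ∎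
  where
  open ≡-Reasoning
  a₁ = proj₁ (remQuot {suc n} (n !) x)
  r₁ = proj₂ (remQuot {suc n} (n !) x)
  a₂ = proj₁ (remQuot {suc n} (n !) y)
  r₂ = proj₂ (remQuot {suc n} (n !) y)
  a₁≡a₂ : a₁ ≡ a₂
  a₁≡a₂ = e zero
  r₁≡r₂ : r₁ ≡ r₂
  r₁≡r₂ = lehmer-injective n r₁ r₂ λ i → punchIn-injective a₁ _ _ (begin
    punchIn a₁ (lehmer n r₁ ⟨$⟩ʳ i)   ≡⟨ insert-punchIn zero a₁ (lehmer n r₁) i ⟨
    lehmer (suc n) x ⟨$⟩ʳ suc i       ≡⟨ e (suc i) ⟩
    lehmer (suc n) y ⟨$⟩ʳ suc i       ≡⟨ insert-punchIn zero a₂ (lehmer n r₂) i ⟩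
    punchIn a₂ (lehmer n r₂ ⟨$⟩ʳ i)   ≡⟨ cong (λ a → punchIn a (lehmer n r₂ ⟨$⟩ʳ i)) a₁≡a₂ ⟨
    punchIn a₁ (lehmer n r₂ ⟨$⟩ʳ i)   ∎)

encoding-≤ : ∀ {a N} (h : Fin a → ℕ) → (∀ x → h x < N) → (∀ x y → h x ≡ h y → x ≡ y) → a ≤ N
encoding-≤ h h<N h-inj = injective⇒≤ {f = λ x → fromℕ< (h<N x)} λ {x} {y} e →
  h-inj x y (trans (sym (toℕ-fromℕ< (h<N x))) (trans (cong toℕ e) (toℕ-fromℕ< (h<N y))))

discrete-ivt : (g : ℕ → ℕ) → (∀ n → g (suc n) ≤ suc (g n)) → ∀ {k} N → g 0 ≤ k → k ≤ g N →
               Σ ℕ λ n → n ≤ N × g n ≡ k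
discrete-ivt g step zero g0≤k k≤gN = 0 , z≤n , ≤-antisym g0≤k k≤gN
discrete-ivt g step {k} (suc N) g0≤k k≤gN with k ≤? g N
... | yes k≤gN' with n , n≤N , gn≡k ← discrete-ivt g step N g0≤k k≤gN' = n , m≤n⇒m≤1+n n≤N , gn≡k
... | no k≰gN = suc N , ≤-refl , ≤-antisym (≤-trans (step N) (≰⇒> k≰gN)) k≤gN

-- Squared central binomial estimate C(2j,j)² ≥ 16^j / (4j), cleared of
-- denominators; proved for j ≥ 1 by induction, the ratio of consecutive
-- terms being 4(2j+1)²/(j+1)² ≥ 16j/(j+1).
central-binomial : ∀ j → 4 ^ (suc j + suc j) * (suc j ! * suc j ! * (suc j ! * suc j !))
                         ≤ 4 * suc j * ((suc j + suc j) ! * (suc j + suc j) !)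
central-binomial zero = ≤-refl
central-binomial (suc i) = begin
    4 ^ (j' + j') * (j' * F * (j' * F) * (j' * F * (j' * F)))
  ≡⟨ cong (λ e → 4 ^ e * (j' * F * (j' * F) * (j' * F * (j' * F)))) (double-suc j) ⟩
    4 * (4 * 4 ^ (j + j)) * (j' * F * (j' * F) * (j' * F * (j' * F)))
  ≡⟨ regroup₁ (4 ^ (j + j)) F j ⟩
    16 * (j' * j' * (j' * j')) * (4 ^ (j + j) * (F * F * (F * F)))
  ≤⟨ *-monoʳ-≤ (16 * (j' * j' * (j' * j'))) (central-binomial i) ⟩
    16 * (j' * j' * (j' * j')) * (4 * j * (X * X))
  ≡⟨ regroup₂ X j ⟩
    16 * (j' * j' * j') * (X * X) * (4 * j * j')
  ≤⟨ *-monoʳ-≤ (16 * (j' * j' * j') * (X * X)) (≤-trans (m≤m+n _ 1) (≤-reflexive (square-odd j))) ⟩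
    16 * (j' * j' * j') * (X * X) * (suc (j + j) * suc (j + j))
  ≡⟨ regroup₃ X j ⟩
    4 * j' * (2+ (j + j) * (suc (j + j) * X) * (2+ (j + j) * (suc (j + j) * X)))
  ≡⟨ cong (λ e → 4 * j' * (e ! * e !)) (double-suc j) ⟨
    4 * j' * ((j' + j') ! * (j' + j') !)
  ∎
  where
  open ≤-Reasoning
  j = suc i
  j' = suc j
  F = j !
  X = (j + j) !
  double-suc : ∀ j → suc j + suc j ≡ 2+ (j + j)
  double-suc j = cong suc (+-suc j j)
  regroup₁ : ∀ A F j → 4 * (4 * A) * (suc j * F * (suc j * F) * (suc j * F * (suc j * F)))
                       ≡ 16 * (suc j * suc j * (suc j * suc j)) * (A * (F * F * (F * F)))
  regroup₁ = solve-∀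
  regroup₂ : ∀ X j → 16 * (suc j * suc j * (suc j * suc j)) * (4 * j * (X * X))
                     ≡ 16 * (suc j * suc j * suc j) * (X * X) * (4 * j * suc j)
  regroup₂ = solve-∀
  square-odd : ∀ j → 4 * j * suc j + 1 ≡ suc (j + j) * suc (j + j)
  square-odd = solve-∀
  regroup₃ : ∀ X j → 16 * (suc j * suc j * suc j) * (X * X) * (suc (j + j) * suc (j + j))
                     ≡ 4 * suc j * (2+ (j + j) * (suc (j + j) * X) * (2+ (j + j) * (suc (j + j) * X)))
  regroup₃ = solve-∀

-- k splits m evenly enough that C(m,k)² ≥ 4^(m−1)/m (stated without division).
EvenSplit : ℕ → ℕ → Set
EvenSplit m k = 4 ^ (m ∸ 1) * (k ! * (m ∸ k) ! * (k ! * (m ∸ k) !)) ≤ m * (m ! * m !)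

even-split-even : ∀ i → EvenSplit (suc i + suc i) (suc i)
even-split-even i rewrite m+n∸n≡m (suc i) (suc i) = *-cancelˡ-≤ 4 (begin
    4 * (4 ^ (i + j) * (F * F * (F * F)))
  ≡⟨ *-assoc 4 (4 ^ (i + j)) _ ⟨
    4 ^ (j + j) * (F * F * (F * F))
  ≤⟨ central-binomial i ⟩
    4 * j * (X * X)
  ≤⟨ *-monoˡ-≤ (X * X) (*-monoʳ-≤ 4 (m≤m+n j j)) ⟩
    4 * (j + j) * (X * X)
  ≡⟨ *-assoc 4 (j + j) (X * X) ⟩
    4 * ((j + j) * (X * X))
  ∎)
  where
  open ≤-Reasoning
  j = suc i
  F = j !
  X = (j + j) !

even-split-odd : ∀ i → EvenSplit (suc (suc i + suc i)) (suc i)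
even-split-odd i = subst (λ d → 4 ^ (j + j) * (F * d ! * (F * d !)) ≤ suc (j + j) * (M * M))
                          (sym (m+n∸n≡m (suc j) j)) (begin
    4 ^ (j + j) * (F * G * (F * G))
  ≡⟨ regroup₁ (4 ^ (j + j)) F j ⟩
    suc j * suc j * (4 ^ (j + j) * (F * F * (F * F)))
  ≤⟨ *-monoʳ-≤ (suc j * suc j) (central-binomial i) ⟩
    suc j * suc j * (4 * j * (X * X))
  ≡⟨ regroup₂ X j ⟩
    4 * j * (suc j * suc j) * (X * X)
  ≤⟨ *-monoˡ-≤ (X * X) (≤-trans (m≤m+n (4 * j * (suc j * suc j)) _) (≤-reflexive (cube-odd j))) ⟩
    suc (j + j) * suc (j + j) * suc (j + j) * (X * X)
  ≡⟨ regroup₃ X j ⟩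
    suc (j + j) * (M * M)
  ∎)
  where
  open ≤-Reasoning
  j = suc i
  F = j !
  G = suc j !
  X = (j + j) !
  M = suc (j + j) !
  regroup₁ : ∀ A F j → A * (F * (suc j * F) * (F * (suc j * F))) ≡ suc j * suc j * (A * (F * F * (F * F)))
  regroup₁ = solve-∀
  regroup₂ : ∀ X j → suc j * suc j * (4 * j * (X * X)) ≡ 4 * j * (suc j * suc j) * (X * X)
  regroup₂ = solve-∀
  cube-odd : ∀ j → 4 * j * (suc j * suc j) + (4 * j * j * j + 4 * j * j + 2 * j + 1)
                   ≡ suc (j + j) * suc (j + j) * suc (j + j)
  cube-odd = solve-∀
  regroup₃ : ∀ X j → suc (j + j) * suc (j + j) * suc (j + j) * (X * X)
                     ≡ suc (j + j) * (suc (j + j) * X * (suc (j + j) * X))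
  regroup₃ = solve-∀

halve : ∀ m → Σ ℕ λ j → m ≡ j + j ⊎ m ≡ suc (j + j)
halve zero = 0 , inj₁ refl
halve (suc m) with halve m
... | j , inj₁ refl = j , inj₂ refl
... | j , inj₂ refl = suc j , inj₁ (cong suc (sym (+-suc j j)))

-- Every m ≥ 2 has an even split 1 ≤ k ≤ m, namely k = ⌊m/2⌋.
even-split : ∀ m → 2 ≤ m → Σ ℕ λ k → 1 ≤ k × k ≤ m × EvenSplit m k
even-split m 2≤m with halve m
... | zero , inj₁ refl with () ← 2≤m
... | zero , inj₂ refl with s≤s () ← 2≤m
... | suc i , inj₁ refl = suc i , s≤s z≤n , m≤m+n _ _ , even-split-even i
... | suc i , inj₂ refl = suc i , s≤s z≤n , m≤n⇒m≤1+n (m≤m+n _ _) , even-split-odd i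

^-distribʳ-* : ∀ a b n → (a * b) ^ n ≡ a ^ n * b ^ n
^-distribʳ-* a b zero = refl
^-distribʳ-* a b (suc n) = trans (cong (a * b *_) (^-distribʳ-* a b n)) (interchange a b (a ^ n) (b ^ n))
  where
  interchange : ∀ a b c d → a * b * (c * d) ≡ a * c * (b * d)
  interchange = solve-∀

-- The final estimate: for w + 1 ≤ m, from m! ≤ m²·2^w·F and
-- 4^(m−1)·F² ≤ m·m!² it follows that 4^(m−(w+1)) ≤ m⁵, which squared is
-- the claimed bound.
width-arithmetic : ∀ m w F → 1 ≤ F → w + 1 ≤ m → m ! ≤ m * m * (2 ^ w * F) →
                   4 ^ (m ∸ 1) * (F * F) ≤ m * (m ! * m !) → 2 ^ (4 * (m ∸ (w + 1))) ≤ (m * m) ^ 5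
width-arithmetic m w F 1≤F w+1≤m m!≤ 4^F²≤ = begin
    2 ^ (4 * d)      ≡⟨ ^-*-assoc 2 4 d ⟨
    (4 * 4) ^ d      ≡⟨ ^-distribʳ-* 4 4 d ⟩
    4 ^ d * 4 ^ d    ≤⟨ *-mono-≤ 4^d≤m⁵ 4^d≤m⁵ ⟩
    m⁵ * m⁵          ≡⟨ fifth-power m ⟨
    (m * m) ^ 5      ∎
  where
  open ≤-Reasoning
  d = m ∸ (w + 1)
  m⁵ = m * (m * m) * (m * m)
  instance
    4^wF²≢0 : NonZero (4 ^ w * (F * F))
    4^wF²≢0 = >-nonZero (*-mono-≤ (m^n>0 4 w) (*-mono-≤ 1≤F 1≤F))
  m∸1≡d+w : m ∸ 1 ≡ d + w
  m∸1≡d+w = trans (cong (_∸ 1) (sym (trans (+-assoc d w 1) (m∸n+n≡m w+1≤m)))) (m+n∸n≡m (d + w) 1)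
  fifth-power : ∀ x → x * x * (x * x * (x * x * (x * x * (x * x * 1))))
                      ≡ x * (x * x) * (x * x) * (x * (x * x) * (x * x))
  fifth-power = solve-∀
  regroup : ∀ x a G → x * (x * x * (a * G) * (x * x * (a * G))) ≡ x * (x * x) * (x * x) * (a * a * (G * G))
  regroup = solve-∀
  4^d≤m⁵ : 4 ^ d ≤ m⁵
  4^d≤m⁵ = *-cancelʳ-≤ (4 ^ d) m⁵ (4 ^ w * (F * F)) (begin
    4 ^ d * (4 ^ w * (F * F))    ≡⟨ *-assoc (4 ^ d) (4 ^ w) (F * F) ⟨
    4 ^ d * 4 ^ w * (F * F)      ≡⟨ cong (_* (F * F)) (^-distribˡ-+-* 4 d w) ⟨
    4 ^ (d + w) * (F * F)        ≡⟨ cong (λ e → 4 ^ e * (F * F)) m∸1≡d+w ⟨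
    4 ^ (m ∸ 1) * (F * F)        ≤⟨ 4^F²≤ ⟩
    m * (m ! * m !)              ≤⟨ *-monoʳ-≤ m (*-mono-≤ m!≤ m!≤) ⟩
    m * (m * m * (2 ^ w * F) * (m * m * (2 ^ w * F)))  ≡⟨ regroup m (2 ^ w) F ⟩
    m⁵ * (2 ^ w * 2 ^ w * (F * F))  ≡⟨ cong (λ x → m⁵ * (x * (F * F))) (^-distribʳ-* 2 2 w) ⟨
    m⁵ * (4 ^ w * (F * F))       ∎)

size≤width : ∀ {n} (B : NOBDD n) j → NOBDD.size B j ≤ NOBDD.width B
size≤width B = go (NOBDD.size B)
  where
  go : ∀ {k} (s : Fin k → ℕ) j → s j ≤ Vector.foldr _⊔_ 0 s
  go s zero = m≤m⊔n _ _
  go s (suc j) = ≤-trans (go (s ∘ suc) j) (m≤n⊔m _ _)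

module Reachability {n : ℕ} (B : NOBDD n) where
  open NOBDD B

  Level : Set
  Level = Fin (suc ℓ)

  Path : Set
  Path = (j : Level) → Fin (size j)

  FollowsBefore : (Fin n → Bool) → Path → Level → Set
  FollowsBefore σ p J =
    (i : Fin ℓ) → toℕ i < toℕ J → edge i (p (inject₁ i)) (σ (var i)) (p (suc i)) ≡ true

  Reachable : (Fin n → Bool) → (J : Level) → Fin (size J) → Set
  Reachable σ J v = Σ Path λ p → FollowsBefore σ p J × p J ≡ v

  -- The recursion is on the number k = toℕ J of the level, since the level
  -- below suc j is inject₁ j, which is not a subterm of suc j.
  reach-at : (Fin n → Bool) → (k : ℕ) (J : Level) → toℕ J ≡ k → Fin (size J) → Bool
  reach-at σ zero zero _ v = true
  reach-at σ (suc k) (suc j) e v =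
    does (any? λ u → reach-at σ k (inject₁ j) (trans (toℕ-inject₁ j) (suc-injective e)) u
                       ∧ edge j u (σ (var j)) v Bool.≟ true)

  reach : (Fin n → Bool) → (J : Level) → Fin (size J) → Bool
  reach σ J = reach-at σ (toℕ J) J refl

  reach-sound : ∀ σ J v → Reachable σ J v → reach σ J v ≡ true
  reach-sound σ J v (p , follows , refl) = go (toℕ J) J refl follows
    where
    go : ∀ k J (e : toℕ J ≡ k) → FollowsBefore σ p J → reach-at σ k J e (p J) ≡ true
    go zero zero e follows = refl
    go (suc k) (suc j) e follows = dec-true (any? _) (p (inject₁ j) , ∧-intro (go k (inject₁ j) _ follows-below)
                                                                              (follows j ≤-refl))
      where
      follows-below : FollowsBefore σ p (inject₁ j)
      follows-below i i<j = follows i (≤-trans i<j (≤-trans (≤-reflexive (toℕ-inject₁ j)) (n≤1+n _)))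

  update : Path → (J : Level) → Fin (size J) → Path
  update p J v i with i F.≟ J
  ... | yes refl = v
  ... | no _ = p i

  update-here : ∀ p J v → update p J v J ≡ v
  update-here p J v with J F.≟ J
  ... | yes refl = refl
  ... | no J≢J = contradiction refl J≢J

  update-elsewhere : ∀ p J v i → i ≢ J → update p J v i ≡ p i
  update-elsewhere p J v i i≢J with i F.≟ J
  ... | yes refl = contradiction refl i≢J
  ... | no _ = refl

  -- Conversely, every node found by reach is reachable; the path is completed
  -- beyond J by an arbitrary given path d.
  reach-complete : Path → ∀ σ J v → reach σ J v ≡ true → Reachable σ J v
  reach-complete d σ J v = go (toℕ J) J refl v
    where
    go : ∀ k J (e : toℕ J ≡ k) v → reach-at σ k J e v ≡ true → Reachable σ J v
    go zero zero e v _ = update d zero v , (λ i ()) , update-here d zero v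
    go (suc k) (suc j) e v h with u , hu ← does-true (any? _) h
                              with p , follows , pj≡u ← go k (inject₁ j) _ u (∧-elimˡ _ hu)
      = update p (suc j) v , follows′ , update-here p (suc j) v
      where
      -- on a level i below suc j the source of the edge is not overwritten
      from-source : ∀ {i} → toℕ i ≤ toℕ j → ∀ {b} → edge i (p (inject₁ i)) (σ (var i)) b ≡ true →
                    edge i (update p (suc j) v (inject₁ i)) (σ (var i)) b ≡ true
      from-source {i} i≤j = subst (λ a → edge i a _ _ ≡ true) (sym (update-elsewhere p (suc j) v (inject₁ i)
        λ eq → <-irrefl (trans (sym (toℕ-inject₁ i)) (cong toℕ eq)) (s≤s i≤j)))
      follows′ : FollowsBefore σ (update p (suc j) v) (suc j)
      follows′ i (s≤s i≤j) with i F.≟ j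
      ... | yes refl = from-source i≤j (subst (λ a → edge i a _ v ≡ true) (sym pj≡u) (∧-elimʳ _ hu))
      ... | no i≢j = from-source i≤j
        (follows i (≤-trans (≤∧≢⇒< i≤j (i≢j ∘ toℕ-injective)) (≤-reflexive (sym (toℕ-inject₁ j)))))

  graft : Path → Path → Level → Path
  graft q p J i with toℕ i <? toℕ J
  ... | yes _ = q i
  ... | no _ = p i

  graft-before : ∀ q p J i → toℕ i < toℕ J → graft q p J i ≡ q i
  graft-before q p J i i<J with toℕ i <? toℕ J
  ... | yes _ = refl
  ... | no i≮J = contradiction i<J i≮J

  graft-from : ∀ q p J i → toℕ J ≤ toℕ i → graft q p J i ≡ p i
  graft-from q p J i J≤i with toℕ i <? toℕ J
  ... | yes i<J = contradiction i<J (≤⇒≯ J≤i)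
  ... | no _ = refl

  -- If ρ is
  -- accepted then so is τ: the accepting ρ-path crosses level J in a node
  -- reachable on σ, hence on τ, and a τ-path to that node can be continued
  -- along the ρ-path.
  cut-and-paste : ∀ σ τ ρ J → (∀ v → reach σ J v ≡ reach τ J v) →
                  (∀ i → toℕ i < toℕ J → ρ (var i) ≡ σ (var i)) →
                  (∀ i → toℕ J ≤ toℕ i → ρ (var i) ≡ τ (var i)) →
                  Accepts ρ → Accepts τ
  cut-and-paste σ τ ρ J same-reach ρ≡σ ρ≡τ (p , p-edges , p-accepts) = graft q p J , edges , accepts
    where
    σ-prefix : FollowsBefore σ p J
    σ-prefix i i<J = subst (λ b → edge i (p (inject₁ i)) b (p (suc i)) ≡ true) (ρ≡σ i i<J) (p-edges i)
    τ-prefix : Reachable τ J (p J)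
    τ-prefix = reach-complete p τ J (p J)
                 (trans (sym (same-reach (p J))) (reach-sound σ J (p J) (p , σ-prefix , refl)))
    q = proj₁ τ-prefix
    q-follows = proj₁ (proj₂ τ-prefix)
    qJ≡pJ = proj₂ (proj₂ τ-prefix)
    Edge : (i : Fin ℓ) → Fin (size (inject₁ i)) → Fin (size (suc i)) → Set
    Edge i a b = edge i a (τ (var i)) b ≡ true
    edges : (i : Fin ℓ) → Edge i (graft q p J (inject₁ i)) (graft q p J (suc i))
    edges i with toℕ i <? toℕ J
    ... | no i≮J = subst₂ (Edge i) (sym (graft-from q p J (inject₁ i) J≤i′))
                                   (sym (graft-from q p J (suc i) (m≤n⇒m≤1+n J≤i)))
                     (subst (λ b → edge i (p (inject₁ i)) b (p (suc i)) ≡ true) (ρ≡τ i J≤i) (p-edges i))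
      where
      J≤i = ≮⇒≥ i≮J
      J≤i′ = subst (toℕ J ≤_) (sym (toℕ-inject₁ i)) J≤i
    ... | yes i<J = subst (Edge i (graft q p J (inject₁ i))) (sym target)
                      (subst (λ a → Edge i a (q (suc i))) (sym (graft-before q p J (inject₁ i) i<J′))
                             (q-follows i i<J))
      where
      i<J′ = subst (_< toℕ J) (sym (toℕ-inject₁ i)) i<J
      -- the node after level i is q's, also when suc i is the crossing level J
      target : graft q p J (suc i) ≡ q (suc i)
      target = by-cases (suc (toℕ i) <? toℕ J)
        where
        by-cases : Dec (suc (toℕ i) < toℕ J) → graft q p J (suc i) ≡ q (suc i)
        by-cases (yes si<J) = graft-before q p J (suc i) si<J
        by-cases (no si≮J) = trans (graft-from q p J (suc i) (≮⇒≥ si≮J))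
          (sym (subst (λ K → q K ≡ p K) (sym (toℕ-injective (≤-antisym i<J (≮⇒≥ si≮J)))) qJ≡pJ))
    accepts : accepting (graft q p J (fromℕ ℓ)) ≡ true
    accepts = trans (cong accepting (graft-from q p J (fromℕ ℓ) J≤ℓ)) p-accepts
      where J≤ℓ = subst (toℕ J ≤_) (sym (toℕ-fromℕ ℓ)) (s≤s⁻¹ (toℕ<n J))

  accepts-cong : ∀ σ τ → (∀ i → σ (var i) ≡ τ (var i)) → Accepts σ → Accepts τ
  accepts-cong σ τ σ≡τ (p , p-edges , p-accepts) =
    p , (λ i → subst (λ b → edge i (p (inject₁ i)) b (p (suc i)) ≡ true) (σ≡τ i) (p-edges i)) , p-accepts

≟-refl : ∀ {n} (x : Fin n) → does (x F.≟ x) ≡ true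
≟-refl x = dec-true (x F.≟ x) refl

does-⇔ : ∀ {P Q : Set} (P? : Dec P) (Q? : Dec Q) → (P → Q) → (Q → P) → does P? ≡ does Q?
does-⇔ (yes p) (yes q) _ _ = refl
does-⇔ (no ¬p) (no ¬q) _ _ = refl
does-⇔ (yes p) (no ¬q) to _ = contradiction (to p) ¬q
does-⇔ (no ¬p) (yes q) _ from = contradiction (from q) ¬p

entry : ∀ {m} → Permutation′ m → Fin m → Fin m → Bool
entry π i y = does (π ⟨$⟩ʳ i F.≟ y)

entry-inverse : ∀ {m} (π : Permutation′ m) i y → entry π i y ≡ does (π ⟨$⟩ˡ y F.≟ i)
entry-inverse π i y = does-⇔ (π ⟨$⟩ʳ i F.≟ y) (π ⟨$⟩ˡ y F.≟ i)
  (λ πi≡y → trans (cong (π ⟨$⟩ˡ_) (sym πi≡y)) (inverseˡ π))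
  (λ π⁻¹y≡i → trans (cong (π ⟨$⟩ʳ_) (sym π⁻¹y≡i)) (inverseʳ π))

permutation-input : ∀ {m} → Permutation′ m → Fin (m * m) → Bool
permutation-input {m} π c = entry π (proj₁ (remQuot {m} m c)) (proj₂ (remQuot {m} m c))

permutation-input-entry : ∀ {m} (π : Permutation′ m) i y → Matrix m (permutation-input π) i y ≡ entry π i y
permutation-input-entry {m} π i y = cong (λ p → entry π (proj₁ p) (proj₂ p)) (remQuot-combine {m} {m} i y)

permutation-matrix : ∀ {m} (π : Permutation′ m) → IsPermutationMatrix m (Matrix m (permutation-input π))
permutation-matrix {m} π = row , column
  where
  A = Matrix m (permutation-input π)
  row : ∀ i → Σ (Fin m) λ y → A i y ≡ true × (∀ y' → A i y' ≡ true → y' ≡ y)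
  row i = π ⟨$⟩ʳ i , trans (permutation-input-entry π i _) (≟-refl (π ⟨$⟩ʳ i)) ,
          λ y Aiy → sym (does-true (_ F.≟ y) (trans (sym (permutation-input-entry π i y)) Aiy))
  column : ∀ y → Σ (Fin m) λ x → A x y ≡ true × (∀ x' → A x' y ≡ true → x' ≡ x)
  column y = π ⟨$⟩ˡ y ,
             trans (permutation-input-entry π _ y) (trans (entry-inverse π _ y) (≟-refl (π ⟨$⟩ˡ y))) ,
             λ x Axy → sym (does-true (_ F.≟ x)
                              (trans (sym (entry-inverse π x y)) (trans (sym (permutation-input-entry π x y)) Axy)))

one-in-row : ∀ {m} (A S : Fin m → Fin m → Bool) (f : Fin m → Fin m) →
             (∀ i y → S i y ≡ true → A i y ≡ does (f i F.≟ y)) →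
             ∀ i y → A i y ≡ true → (∀ y' → A i y' ≡ true → y' ≡ y) → S i (f i) ≡ S i y
one-in-row A S f agree i y Aiy unique with S i y in Siy
... | true = trans (cong (S i) fi≡y) Siy
  where
  fi≡y : f i ≡ y
  fi≡y = does-true (f i F.≟ y) (trans (sym (agree i y Siy)) Aiy)
... | false with S i (f i) in Sifi
...   | false = refl
...   | true = contradiction (trans (sym (trans (cong (S i) (sym fi≡y)) Sifi)) Siy) λ ()
  where
  fi≡y : f i ≡ y
  fi≡y = unique (f i) (trans (agree i (f i) Sifi) (≟-refl (f i)))

-- The same for the only one of a column, by transposition.
one-in-column : ∀ {m} (A S : Fin m → Fin m → Bool) (π : Permutation′ m) →
                (∀ i y → S i y ≡ true → A i y ≡ entry π i y) →
                ∀ x y → A x y ≡ true → (∀ x' → A x' y ≡ true → x' ≡ x) → S (π ⟨$⟩ˡ y) y ≡ S x y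
one-in-column A S π agree x y Axy unique =
  one-in-row (λ y x → A x y) (λ y x → S x y) (π ⟨$⟩ˡ_)
             (λ y x Sxy → trans (agree x y Sxy) (entry-inverse π x y))
             y x Axy unique

-- Throughout, B is a read-once NOBDD computing notPERM on m × m matrices, m ≥ 1.
module Fooling (m : ℕ) (z : Fin m) (B : NOBDD (m * m)) (read-once : ReadOnce B)
               (computes : Computes B (NotPERM m)) where
  open NOBDD B
  open Reachability B

  rejects-permutations : ∀ π → ¬ Accepts (permutation-input π)
  rejects-permutations π accepted =
    Equivalence.to (computes (permutation-input π)) accepted (permutation-matrix π)

  accepts-non-permutations : ∀ σ → NotPERM m σ → Accepts σ
  accepts-non-permutations σ = Equivalence.from (computes σ)

  -- The zero matrix is no permutation matrix (m ≥ 1), so it is accepted; as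
  -- B is read-once, the levels of the accepting path, i.e. all levels, read
  -- distinct variables.
  zero-accepted : Accepts (λ _ → false)
  zero-accepted = accepts-non-permutations _ λ isPerm → contradiction (proj₁ (proj₂ (proj₁ isPerm z))) λ ()

  var-injective : ∀ i j → var i ≡ var j → i ≡ j
  var-injective = read-once (proj₁ zero-accepted , λ i → false , proj₁ (proj₂ zero-accepted) i)

  length≤n : ℓ ≤ m * m
  length≤n = injective⇒≤ (var-injective _ _)

  -- Every variable is read: if c were not, switching entry c off in a
  -- permutation matrix with a one at c would give an accepted input that B
  -- cannot distinguish from the (rejected) permutation matrix.
  every-variable-read : ∀ c → Σ (Fin ℓ) λ i → var i ≡ c
  every-variable-read c with any? (λ i → var i F.≟ c)
  ... | yes read = read
  ... | no unread = ⊥-elim (rejects-permutations π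
                      (accepts-cong σ (permutation-input π) unchanged (accepts-non-permutations σ not-perm)))
    where
    r = proj₁ (remQuot {m} m c)
    col = proj₂ (remQuot {m} m c)
    π = Perm.transpose r col
    π-r : π ⟨$⟩ʳ r ≡ col
    π-r rewrite dec-true (r F.≟ r) refl = refl
    σ : Fin (m * m) → Bool
    σ x = permutation-input π x ∧ not (does (x F.≟ c))
    -- row r of σ has no one
    not-perm : NotPERM m σ
    not-perm isPerm with y , σry , _ ← proj₁ isPerm r =
      contradiction (trans (sym (cong not (dec-true (combine r y F.≟ c) ry≡c))) (∧-elimʳ _ σry)) λ ()
      where
      πr≡y : π ⟨$⟩ʳ r ≡ y
      πr≡y = does-true (_ F.≟ y) (trans (sym (permutation-input-entry π r y)) (∧-elimˡ _ σry))
      ry≡c : combine r y ≡ c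
      ry≡c = trans (cong (combine r) (trans (sym πr≡y) π-r)) (combine-remQuot {m} m c)
    unchanged : ∀ i → σ (var i) ≡ permutation-input π (var i)
    unchanged i rewrite dec-false (var i F.≟ c) (λ e → unread (i , e)) = Bool.∧-identityʳ _

  level : Fin (m * m) → Fin ℓ
  level c = proj₁ (every-variable-read c)

  var-level : ∀ c → var (level c) ≡ c
  var-level c = proj₂ (every-variable-read c)

  level-var : ∀ i → level (var i) ≡ i
  level-var i = var-injective _ _ (var-level (var i))

  depth : Fin (m * m) → ℕ
  depth c = toℕ (level c)

  early : ℕ → Fin m → Fin m → Bool
  early t x y = depth (combine x y) <ᵇ t

  early-rows : Permutation′ m → ℕ → Fin m → Bool
  early-rows π t x = early t x (π ⟨$⟩ʳ x)

  early-columns : Permutation′ m → ℕ → Fin m → Bool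
  early-columns π t y = early t (π ⟨$⟩ˡ y) y

  mix : Permutation′ m → Permutation′ m → ℕ → Fin (m * m) → Bool
  mix π ρ t c = if depth c <ᵇ t then permutation-input π c else permutation-input ρ c

  mix-at : ∀ π ρ t c {b} → (depth c <ᵇ t) ≡ b →
           mix π ρ t c ≡ (if b then permutation-input π c else permutation-input ρ c)
  mix-at π ρ t c = cong (λ b → if b then permutation-input π c else permutation-input ρ c)

  mix-early : ∀ π ρ t x y → early t x y ≡ true → Matrix m (mix π ρ t) x y ≡ entry π x y
  mix-early π ρ t x y early-xy = trans (mix-at π ρ t (combine x y) early-xy) (permutation-input-entry π x y)

  mix-late : ∀ π ρ t x y → not (early t x y) ≡ true → Matrix m (mix π ρ t) x y ≡ entry ρ x y
  mix-late π ρ t x y late-xy =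
    trans (mix-at π ρ t (combine x y) (Bool.not-injective late-xy)) (permutation-input-entry ρ x y)

  -- If the mixed input is a permutation matrix, π and ρ have the same early
  -- rows: both agree with whether the one of the row is early in the mix.
  mix-early-rows : ∀ π ρ t → IsPermutationMatrix m (Matrix m (mix π ρ t)) →
                   ∀ x → early-rows π t x ≡ early-rows ρ t x
  mix-early-rows π ρ t isPerm x with y , Axy , unique ← proj₁ isPerm x =
    trans (one-in-row A (early t) (π ⟨$⟩ʳ_) (mix-early π ρ t) x y Axy unique)
          (sym (Bool.not-injective (one-in-row A late (ρ ⟨$⟩ʳ_) (mix-late π ρ t) x y Axy unique)))
    where
    A = Matrix m (mix π ρ t)
    late = λ x y → not (early t x y)

  mix-early-columns : ∀ π ρ t → IsPermutationMatrix m (Matrix m (mix π ρ t)) →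
                      ∀ y → early-columns π t y ≡ early-columns ρ t y
  mix-early-columns π ρ t isPerm y with x , Axy , unique ← proj₂ isPerm y =
    trans (one-in-column A (early t) π (mix-early π ρ t) x y Axy unique)
          (sym (Bool.not-injective (one-in-column A late ρ (mix-late π ρ t) x y Axy unique)))
    where
    A = Matrix m (mix π ρ t)
    late = λ x y → not (early t x y)

  SameReach : Permutation′ m → Permutation′ m → Level → Set
  SameReach π ρ J = ∀ v → reach (permutation-input π) J v ≡ reach (permutation-input ρ) J v

  -- Fooling: if π and ρ look alike at level J, the input mixing them at J
  -- cannot fail to be a permutation matrix: otherwise it is accepted, and by
  -- cut and paste so is the permutation matrix of ρ.
  mix-is-permutation : ∀ π ρ J → SameReach π ρ J →
                       ¬ ¬ IsPermutationMatrix m (Matrix m (mix π ρ (toℕ J)))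
  mix-is-permutation π ρ J same not-perm =
    rejects-permutations ρ (cut-and-paste (permutation-input π) (permutation-input ρ) (mix π ρ (toℕ J)) J same
                             before after (accepts-non-permutations (mix π ρ (toℕ J)) not-perm))
    where
    depth-var : ∀ i → depth (var i) ≡ toℕ i
    depth-var i = cong toℕ (level-var i)
    before : ∀ i → toℕ i < toℕ J → mix π ρ (toℕ J) (var i) ≡ permutation-input π (var i)
    before i i<J = mix-at π ρ (toℕ J) (var i) (trans (cong (_<ᵇ toℕ J) (depth-var i)) (<ᵇ-complete i<J))
    after : ∀ i → toℕ J ≤ toℕ i → mix π ρ (toℕ J) (var i) ≡ permutation-input ρ (var i)
    after i J≤i = mix-at π ρ (toℕ J) (var i) (trans (cong (_<ᵇ toℕ J) (depth-var i)) (<ᵇ-false J≤i))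

  same-early-rows : ∀ π ρ J → SameReach π ρ J → ∀ x → early-rows π (toℕ J) x ≡ early-rows ρ (toℕ J) x
  same-early-rows π ρ J same x = decidable-stable (_ Bool.≟ _)
    λ differ → mix-is-permutation π ρ J same λ isPerm → differ (mix-early-rows π ρ (toℕ J) isPerm x)

  same-early-columns : ∀ π ρ J → SameReach π ρ J →
                       ∀ y → early-columns π (toℕ J) y ≡ early-columns ρ (toℕ J) y
  same-early-columns π ρ J same y = decidable-stable (_ Bool.≟ _)
    λ differ → mix-is-permutation π ρ J same λ isPerm → differ (mix-early-columns π ρ (toℕ J) isPerm y)

-- The encoding of permutations, for a fixed target number k of early rows.
module Counting (m : ℕ) (z : Fin m) (B : NOBDD (m * m)) (read-once : ReadOnce B)
                (computes : Computes B (NotPERM m)) (k : ℕ) (1≤k : 1 ≤ k) (k≤m : k ≤ m) where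
  open NOBDD B
  open Reachability B
  open Fooling m z B read-once computes

  early-columns-image : ∀ π t x → early-columns π t (π ⟨$⟩ʳ x) ≡ early-rows π t x
  early-columns-image π t x = cong (λ x′ → early t x′ (π ⟨$⟩ʳ x)) (inverseˡ π)

  early-rows-image : ∀ π t y → early-rows π t (π ⟨$⟩ˡ y) ≡ early-columns π t y
  early-rows-image π t y = cong (early t (π ⟨$⟩ˡ y)) (inverseʳ π)

  permutation-injective : ∀ (π : Permutation′ m) x y → π ⟨$⟩ʳ x ≡ π ⟨$⟩ʳ y → x ≡ y
  permutation-injective π x y e = trans (sym (inverseˡ π)) (trans (cong (π ⟨$⟩ˡ_) e) (inverseˡ π))

  early-injects : ∀ π t → InjectsInto (early-rows π t) (early-columns π t) (π ⟨$⟩ʳ_)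
  early-injects π t = record
    { maps-into = λ x h → trans (early-columns-image π t x) h
    ; injective = λ x y _ _ → permutation-injective π x y }

  late-injects : ∀ π t → InjectsInto (not ∘ early-rows π t) (not ∘ early-columns π t) (π ⟨$⟩ʳ_)
  late-injects π t = record
    { maps-into = λ x h → trans (cong not (early-columns-image π t x)) h
    ; injective = λ x y _ _ → permutation-injective π x y }

  count-early-columns : ∀ π t → count (early-columns π t) ≡ count (early-rows π t)
  count-early-columns π t =
    ≤-antisym (injection-count-≤ inverse-injects) (injection-count-≤ (early-injects π t))
    where
    inverse-injects : InjectsInto (early-columns π t) (early-rows π t) (π ⟨$⟩ˡ_)
    inverse-injects = record
      { maps-into = λ y h → trans (early-rows-image π t y) h
      ; injective = λ x y _ _ e → trans (sym (inverseʳ π)) (trans (cong (π ⟨$⟩ʳ_) e) (inverseʳ π)) }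

  -- Moving the cut down one level makes at most one more row early, as
  -- distinct cells are read on distinct levels.
  early-rows-step : ∀ π t → count (early-rows π (suc t)) ≤ suc (count (early-rows π t))
  early-rows-step π t = begin
      count (early-rows π (suc t))                  ≤⟨ count-mono split ⟩
      count (λ x → early-rows π t x ∨ at-t x)       ≤⟨ count-∨ (early-rows π t) at-t ⟩
      count (early-rows π t) + count at-t           ≤⟨ +-monoʳ-≤ _ (count-atMostOne at-t one-row) ⟩
      count (early-rows π t) + 1                    ≡⟨ +-comm _ 1 ⟩
      suc (count (early-rows π t))                  ∎
    where
    open ≤-Reasoning
    cell : Fin m → Fin (m * m)
    cell x = combine x (π ⟨$⟩ʳ x)
    at-t : Fin m → Bool
    at-t x = does (depth (cell x) ≟ t)
    split : early-rows π (suc t) ⊆ (λ x → early-rows π t x ∨ at-t x)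
    split x h with m<1+n⇒m<n∨m≡n (<ᵇ-sound h)
    ... | inj₁ lt = cong (_∨ at-t x) (<ᵇ-complete lt)
    ... | inj₂ eq = trans (cong (early-rows π t x ∨_) (dec-true (depth (cell x) ≟ t) eq)) (Bool.∨-zeroʳ _)
    same-depth⇒same-cell : ∀ x y → depth (cell x) ≡ depth (cell y) → cell x ≡ cell y
    same-depth⇒same-cell x y e =
      trans (sym (var-level (cell x))) (trans (cong var (toℕ-injective e)) (var-level (cell y)))
    one-row : ∀ x y → at-t x ≡ true → at-t y ≡ true → x ≡ y
    one-row x y hx hy = combine-injectiveˡ x (π ⟨$⟩ʳ x) y (π ⟨$⟩ʳ y)
      (same-depth⇒same-cell x y (trans (does-true (_ ≟ t) hx) (sym (does-true (_ ≟ t) hy))))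

  -- A balanced cut of π: after level i (i.e. at level suc i) exactly k rows are early.
  Balanced : Permutation′ m → Fin ℓ → Set
  Balanced π i = count (early-rows π (suc (toℕ i))) ≡ k

  no-early-rows : ∀ π → count (early-rows π 0) ≡ 0
  no-early-rows π = count-empty (early-rows π 0) λ _ → refl

  all-early-rows : ∀ π → count (early-rows π ℓ) ≡ m
  all-early-rows π = count-full (early-rows π ℓ) λ x → <ᵇ-complete (toℕ<n (level _))

  -- The number of early rows grows from 0 to m by steps of at most one, so it
  -- passes through k; the cut is not at level 0 as k ≥ 1.
  balanced-cut : ∀ π → Σ (Fin ℓ) (Balanced π)
  balanced-cut π with discrete-ivt (count ∘ early-rows π) (early-rows-step π) ℓ
                        (≤-trans (≤-reflexive (no-early-rows π)) z≤n)
                        (≤-trans k≤m (≤-reflexive (sym (all-early-rows π))))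
  ... | zero , _ , count≡k = contradiction (trans (sym (no-early-rows π)) count≡k) (<⇒≢ 1≤k)
  ... | suc t , t<ℓ , count≡k =
    fromℕ< t<ℓ , trans (cong (λ t → count (early-rows π (suc t))) (toℕ-fromℕ< t<ℓ)) count≡k

  early-code : Permutation′ m → ℕ → ℕ
  early-code π t = injCode (early-rows π t) (early-columns π t) (π ⟨$⟩ʳ_)

  late-code : Permutation′ m → ℕ → ℕ
  late-code π t = injCode (not ∘ early-rows π t) (not ∘ early-columns π t) (π ⟨$⟩ʳ_)

  early-code-< : ∀ π t → count (early-rows π t) ≡ k → early-code π t < k !
  early-code-< π t count≡k = subst (early-code π t <_) sizes (injCode-< (early-injects π t))
    where
    sizes : falling (count (early-columns π t)) (count (early-rows π t)) ≡ k !
    sizes = trans (cong₂ falling (trans (count-early-columns π t) count≡k) count≡k) (falling-diagonal k)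

  late-code-< : ∀ π t → count (early-rows π t) ≡ k → late-code π t < (m ∸ k) !
  late-code-< π t count≡k = subst (late-code π t <_) sizes (injCode-< (late-injects π t))
    where
    late-rows : count (not ∘ early-rows π t) ≡ m ∸ k
    late-rows = trans (count-complement (early-rows π t)) (cong (m ∸_) count≡k)
    late-columns : count (not ∘ early-columns π t) ≡ m ∸ k
    late-columns = trans (count-complement (early-columns π t))
                         (cong (m ∸_) (trans (count-early-columns π t) count≡k))
    sizes : falling (count (not ∘ early-columns π t)) (count (not ∘ early-rows π t)) ≡ (m ∸ k) !
    sizes = trans (cong₂ falling late-columns late-rows) (falling-diagonal (m ∸ k))

  reach-code-< : ∀ σ J → bitsCode (reach σ J) < 2 ^ width
  reach-code-< σ J = <-≤-trans (bitsCode-< (reach σ J)) (^-monoʳ-≤ 2 (size≤width B J))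

  cut-code : Permutation′ m → Fin ℓ → ℕ
  cut-code π i = bitsCode (reach (permutation-input π) (suc i))
                 + 2 ^ width * (early-code π (suc (toℕ i)) + k ! * late-code π (suc (toℕ i)))

  cut-code-< : ∀ π i → Balanced π i → cut-code π i < 2 ^ width * (k ! * (m ∸ k) !)
  cut-code-< π i balanced =
    numeral-< (reach-code-< _ (suc i))
              (numeral-< (early-code-< π (suc (toℕ i)) balanced) (late-code-< π (suc (toℕ i)) balanced))

  -- At a common balanced cut the recorded data determine the permutation:
  -- equal reached sets force equal early rows and columns (fooling), and the
  -- two bijections are then read off their codes.
  cut-code-injective : ∀ π ρ i → Balanced π i → Balanced ρ i → cut-code π i ≡ cut-code ρ i →
                       ∀ x → π ⟨$⟩ʳ x ≡ ρ ⟨$⟩ʳ x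
  cut-code-injective π ρ i balanced-π balanced-ρ e
    with reach≡ , bijections≡ ← numeral-injective _ _ _ _ (reach-code-< _ (suc i)) (reach-code-< _ (suc i)) e
    with early≡ , late≡ ← numeral-injective _ _ _ _ (early-code-< π (suc (toℕ i)) balanced-π)
                                                           (early-code-< ρ (suc (toℕ i)) balanced-ρ) bijections≡
    = agree
    where
    t = suc (toℕ i)
    same : SameReach π ρ (suc i)
    same = bitsCode-injective _ _ reach≡
    rows = same-early-rows π ρ (suc i) same
    columns = same-early-columns π ρ (suc i) same
    agree : ∀ x → π ⟨$⟩ʳ x ≡ ρ ⟨$⟩ʳ x
    agree x with early-rows π t x in early-x
    ... | true = injCode-injective′ rows columns (early-injects π t) (early-injects ρ t) early≡ x early-x
    ... | false = injCode-injective′ (cong not ∘ rows) (cong not ∘ columns) (late-injects π t) (late-injects ρ t)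
                                     late≡ x (cong not early-x)

  code : Permutation′ m → ℕ
  code π = toℕ (proj₁ (balanced-cut π)) + ℓ * cut-code π (proj₁ (balanced-cut π))

  code-< : ∀ π → code π < ℓ * (2 ^ width * (k ! * (m ∸ k) !))
  code-< π = numeral-< (toℕ<n (proj₁ (balanced-cut π))) (cut-code-< π _ (proj₂ (balanced-cut π)))

  code-injective : ∀ π ρ → code π ≡ code ρ → ∀ x → π ⟨$⟩ʳ x ≡ ρ ⟨$⟩ʳ x
  code-injective π ρ = at-cuts (balanced-cut π) (balanced-cut ρ)
    where
    at-cuts : ((i , _) : Σ (Fin ℓ) (Balanced π)) ((j , _) : Σ (Fin ℓ) (Balanced ρ)) →
              toℕ i + ℓ * cut-code π i ≡ toℕ j + ℓ * cut-code ρ j →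
              ∀ x → π ⟨$⟩ʳ x ≡ ρ ⟨$⟩ʳ x
    at-cuts (i , balanced-π) (j , balanced-ρ) e
      with i≡j , cut-codes≡ ← numeral-injective _ _ _ _ (toℕ<n i) (toℕ<n j) e
      with refl ← toℕ-injective i≡j
      = cut-code-injective π ρ i balanced-π balanced-ρ cut-codes≡

  permutations-encoded : m ! ≤ ℓ * (2 ^ width * (k ! * (m ∸ k) !))
  permutations-encoded = encoding-≤ (code ∘ lehmer m) (code-< ∘ lehmer m)
    λ x y e → lehmer-injective m x y (code-injective (lehmer m x) (lehmer m y) e)

theorem3 : (m : ℕ) → 1 ≤ m → (B : NOBDD (m * m)) → ReadOnce B →
           Computes B (NotPERM m) →
           2 ^ (4 * (m ∸ (NOBDD.width B + 1))) ≤ (m * m) ^ 5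
theorem3 m 1≤m B read-once computes with m ≤? NOBDD.width B + 1
... | yes m≤w+1 rewrite m≤n⇒m∸n≡0 m≤w+1 = ^-monoˡ-≤ 5 (*-mono-≤ 1≤m 1≤m)
... | no m≰w+1 = from-split (even-split m 2≤m)
  where
  w = NOBDD.width B
  w+1<m = ≰⇒> m≰w+1
  2≤m : 2 ≤ m
  2≤m = ≤-trans (s≤s (m≤n+m 1 w)) w+1<m
  from-split : Σ ℕ (λ k → 1 ≤ k × k ≤ m × EvenSplit m k) → 2 ^ (4 * (m ∸ (w + 1))) ≤ (m * m) ^ 5
  from-split (k , 1≤k , k≤m , k-splits) =
    width-arithmetic m w (k ! * (m ∸ k) !) (*-mono-≤ (1≤n! k) (1≤n! (m ∸ k))) (<⇒≤ w+1<m)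
      (≤-trans permutations-encoded (*-monoˡ-≤ (2 ^ w * (k ! * (m ∸ k) !)) length≤n)) k-splits
    where
    open Fooling m (fromℕ< 1≤m) B read-once computes using (length≤n)
    open Counting m (fromℕ< 1≤m) B read-once computes k 1≤k k≤m using (permutations-encoded)
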